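{- Let $A$ be a finite arborescence with weight functions $w:E(A)\to\mathbb{R}_{>0}$ and $c:E(A)\to\mathbb{R}_{>0}$ satisfying the combined triangle inequality $c(e)\le w(e)+\sum_{f\in\delta^+(y)}c(f)$ for all $e=(x,y)\in E(A)$. Then $c(e)\le w(A_e)$ for all $e\in E(A)$.
   Context: An arborescence is a connected directed acyclic graph in which every vertex has in-degree at most 1; it has a unique root (vertex of in-degree 0). $\delta^+(y)$ denotes the set of edges leaving $y$. For $e=(x,y)\in E(A)$, $A_e$ is the sub-arborescence rooted at $x$ consisting of the edge $e$ together with $y$ and all its descendants and the edges among them. For a set or subgraph $F$, $w(F)=\sum_{e\in E(F)}w(e)$, and similarly for $c$. -}

module Defs where

open import Level using (Level; _⊔_) renaming (suc to lsuc)
open import Data.Nat using (ℕ; zero; suc)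
open import Data.Fin using (Fin; zero; suc)
open import Data.Fin.Subset using (Subset; _∈_)
open import Data.Vec using (Vec; []; _∷_)
open import Data.Bool using (Bool; true; false)
open import Data.Sum using (_⊎_)
open import Data.Product using (_×_; ∃)
open import Relation.Nullary using (¬_; Dec; does)
open import Relation.Binary using (Rel; IsTotalOrder)
open import Relation.Binary.PropositionalEquality using (_≡_)
open import Algebra.Bundles using (CommutativeRing)
open import Function.Bundles using (_⇔_)
import Data.Fin as F

-- Ordered fields (ℝ is one).  The weights take values in an arbitrary
-- ordered field; the stdlib has no real numbers.

record OrderedField c ℓ₁ ℓ₂ : Set (lsuc (c ⊔ ℓ₁ ⊔ ℓ₂)) where
  field
    commutativeRing : CommutativeRing c ℓ₁
  open CommutativeRing commutativeRing public
  field
    _≤_          : Rel Carrier ℓ₂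
    isTotalOrder : IsTotalOrder _≈_ _≤_
    +-mono-≤     : ∀ {x y} z → x ≤ y → (x + z) ≤ (y + z)
    *-nonneg     : ∀ {x y} → 0# ≤ x → 0# ≤ y → 0# ≤ (x * y)
    0≉1          : ¬ (0# ≈ 1#)
    inverse      : ∀ x → ¬ (x ≈ 0#) → ∃ λ y → (x * y) ≈ 1#

  _<_ : Rel Carrier (ℓ₁ ⊔ ℓ₂)
  x < y = (x ≤ y) × ¬ (x ≈ y)

record Digraph (n m : ℕ) : Set where
  field
    tail : Fin m → Fin n
    head : Fin m → Fin n

module _ {n m : ℕ} (G : Digraph n m) where
  open Digraph G

  data Reach : Fin n → Fin n → Set where
    here : ∀ {u} → Reach u u
    step : ∀ {v} (f : Fin m) → Reach (head f) v → Reach (tail f) v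

  data UReach : Fin n → Fin n → Set where
    here     : ∀ {u} → UReach u u
    forward  : ∀ {v} (f : Fin m) → UReach (head f) v → UReach (tail f) v
    backward : ∀ {v} (f : Fin m) → UReach (tail f) v → UReach (head f) v

  record IsArborescence : Set where
    field
      connected : ∀ u v → UReach u v
      acyclic   : ∀ (f : Fin m) → ¬ Reach (head f) (tail f)
      indeg≤1   : ∀ (f g : Fin m) → head f ≡ head g → f ≡ g

  -- S is exactly the edge set of A_e: e together with all edges
  -- whose tail is a descendant of head e (head e itself included)
  IsSubArbEdges : Fin m → Subset m → Set
  IsSubArbEdges e S = ∀ f → (f ∈ S) ⇔ ((f ≡ e) ⊎ Reach (head e) (tail f))

module _ {a} {A : Set a} (_+_ : A → A → A) (0# : A) where

  sumSubset : ∀ {m} → Subset m → (Fin m → A) → A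
  sumSubset []          g = 0#
  sumSubset (true ∷ S)  g = g zero + sumSubset S (λ i → g (suc i))
  sumSubset (false ∷ S) g = sumSubset S (λ i → g (suc i))

  sumOut : ∀ {n m} → Digraph n m → Fin n → (Fin m → A) → A
  sumOut {m = zero}  G y g = 0#
  sumOut {m = suc m} G y g =
    let open Digraph G
        rest = sumOut {m = m} (record { tail = λ i → tail (suc i) ; head = λ i → head (suc i) })
                      y (λ i → g (suc i))
    in if′ does (tail zero F.≟ y) then g zero + rest else rest
    where
      if′_then_else_ : Bool → A → A → A
      if′ true  then x else _ = x
      if′ false then _ else z = z

module Submission where

-- Order the edges by descent.  The edge set of A_e is {e} together with the
-- edge sets of A_f for the edges f leaving the head of e, and these are
-- pairwise disjoint because in-degrees are at most 1 (the ancestors of a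
-- vertex form a chain); hence w(A_e) = w(e) + Σ_f w(A_f).  Induction along
-- the descent order then gives
--   c(e) ≤ w(e) + Σ_f c(f) ≤ w(e) + Σ_f w(A_f) = w(A_e).

open import Defs
open import Level using (Level)
open import Data.Nat using (ℕ; zero; suc)
open import Data.Fin using (Fin; zero; suc; _≟_)
open import Data.Fin.Properties using (suc-injective)
open import Data.Fin.Subset using (Subset; _∈_; _∉_; ⊥; ⁅_⁆; _∪_; inside; outside)
open import Data.Fin.Subset.Properties using (⊆-antisym; ∉⊥; x∈⁅y⁆⇔x≡y; x∈⁅y⁆⇒x≡y; x∈p∪q⁺; x∈p∪q⁻)
open import Data.Vec using ([]; _∷_; here; there; tabulate)
open import Data.Vec.Properties using (lookup∘tabulate; []=⇒lookup; lookup⇒[]=)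
open import Data.Product using (_×_; _,_; ∃-syntax)
open import Data.Sum using (_⊎_; inj₁; inj₂)
import Data.Sum as Sum
open import Function using (_∘_)
open import Function.Bundles using (_⇔_; mk⇔; Equivalence)
import Function.Properties.Equivalence as ⇔
open import Relation.Nullary using (¬_; yes; no; does; contradiction)
open import Relation.Nullary.Decidable using (dec-true)
open import Relation.Unary using (Pred; Decidable)
open import Relation.Binary using (Rel; IsStrictPartialOrder)
open import Relation.Binary.Bundles using (TotalOrder)
open import Relation.Binary.PropositionalEquality using (_≡_; refl; sym; trans; subst; resp₂)
import Relation.Binary.PropositionalEquality as ≡
open import Algebra.Bundles using (CommutativeMonoid)
open import Induction.WellFounded using (WellFounded; module All)
open import Data.Fin.Induction using (spo-wellFounded)

open Equivalence using (to; from)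

private
  variable
    k : ℕ
    p q : Level

Represents : Subset k → Pred (Fin k) p → Set p
Represents S P = ∀ x → x ∈ S ⇔ P x

module _ {S T : Subset k} {P : Pred (Fin k) p} where

  Represents-unique : Represents S P → Represents T P → S ≡ T
  Represents-unique S≐P T≐P =
    ⊆-antisym (λ {x} → from (T≐P x) ∘ to (S≐P x)) (λ {x} → from (S≐P x) ∘ to (T≐P x))

  Represents-∪ : {Q : Pred (Fin k) q} → Represents S P → Represents T Q →
                 Represents (S ∪ T) (λ x → P x ⊎ Q x)
  Represents-∪ S≐P T≐Q x = mk⇔
    (λ x∈S∪T → Sum.map (to (S≐P x)) (to (T≐Q x)) (x∈p∪q⁻ S T x∈S∪T))
    (x∈p∪q⁺ ∘ Sum.map (from (S≐P x)) (from (T≐Q x)))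

Represents-⇔ : {S : Subset k} {P Q : Pred (Fin k) p} →
               Represents S P → (∀ x → P x ⇔ Q x) → Represents S Q
Represents-⇔ S≐P P⇔Q x = ⇔.trans (S≐P x) (P⇔Q x)

Represents-tabulate : {P : Pred (Fin k) p} (P? : Decidable P) → Represents (tabulate (does ∘ P?)) P
Represents-tabulate {P = P} P? x = mk⇔ to′ from′
  where
  to′ : x ∈ tabulate (does ∘ P?) → P x
  to′ x∈ with P? x | trans (sym (lookup∘tabulate (does ∘ P?) x)) ([]=⇒lookup x∈)
  ... | yes px | _ = px
  ... | no _   | ()

  from′ : P x → x ∈ tabulate (does ∘ P?)
  from′ px = lookup⇒[]= x _ (trans (lookup∘tabulate (does ∘ P?) x) (dec-true (P? x) px))

module SubsetSum {c ℓ} (M : CommutativeMonoid c ℓ) where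
  open CommutativeMonoid M renaming (refl to ≈-refl; sym to ≈-sym; trans to ≈-trans)
  open import Algebra.Properties.CommutativeSemigroup commutativeSemigroup using (x∙yz≈y∙xz)

  ∑ : Subset k → (Fin k → Carrier) → Carrier
  ∑ = sumSubset _∙_ ε

  ∑-⊥ : ∀ k (g : Fin k → Carrier) → ∑ ⊥ g ≈ ε
  ∑-⊥ zero    g = ≈-refl
  ∑-⊥ (suc k) g = ∑-⊥ k (g ∘ suc)

  ∑-⁅⁆ : (i : Fin k) (g : Fin k → Carrier) → ∑ ⁅ i ⁆ g ≈ g i
  ∑-⁅⁆ {suc k} zero    g = ≈-trans (∙-congˡ (∑-⊥ k (g ∘ suc))) (identityʳ (g zero))
  ∑-⁅⁆         (suc i) g = ∑-⁅⁆ i (g ∘ suc)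

  ∑-∪ : (S T : Subset k) (g : Fin k → Carrier) → (∀ {x} → x ∈ S → x ∉ T) →
        ∑ (S ∪ T) g ≈ ∑ S g ∙ ∑ T g
  ∑-∪ []            []            g disj = ≈-sym (identityˡ ε)
  ∑-∪ (inside  ∷ S) (inside  ∷ T) g disj = contradiction here (disj here)
  ∑-∪ (inside  ∷ S) (outside ∷ T) g disj =
    ≈-trans (∙-congˡ (∑-∪ S T (g ∘ suc) (λ x∈S → disj (there x∈S) ∘ there))) (≈-sym (assoc _ _ _))
  ∑-∪ (outside ∷ S) (inside  ∷ T) g disj =
    ≈-trans (∙-congˡ (∑-∪ S T (g ∘ suc) (λ x∈S → disj (there x∈S) ∘ there))) (x∙yz≈y∙xz _ _ _)
  ∑-∪ (outside ∷ S) (outside ∷ T) g disj =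
    ∑-∪ S T (g ∘ suc) (λ x∈S → disj (there x∈S) ∘ there)

module _ {P : Pred (Fin (suc k)) p} {O : Subset k} where

  ∃-∈-inside∷ : (∃[ f ] f ∈ inside ∷ O × P f) ⇔ (P zero ⊎ ∃[ f ] f ∈ O × P (suc f))
  ∃-∈-inside∷ = mk⇔
    (λ { (zero , _ , Pf) → inj₁ Pf ; (suc f , there f∈O , Pf) → inj₂ (f , f∈O , Pf) })
    (λ { (inj₁ P0) → zero , here , P0 ; (inj₂ (f , f∈O , Pf)) → suc f , there f∈O , Pf })

  ∃-∈-outside∷ : (∃[ f ] f ∈ outside ∷ O × P f) ⇔ (∃[ f ] f ∈ O × P (suc f))
  ∃-∈-outside∷ = mk⇔
    (λ { (suc f , there f∈O , Pf) → f , f∈O , Pf })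
    (λ { (f , f∈O , Pf) → suc f , there f∈O , Pf })

module OrderedSum {a ℓ₁ ℓ₂} (K : OrderedField a ℓ₁ ℓ₂) where
  open OrderedField K using (Carrier; _≤_; _+_; +-comm; +-mono-≤; isTotalOrder; +-commutativeMonoid)
  open SubsetSum +-commutativeMonoid public

  private
    totalOrder : TotalOrder a ℓ₁ ℓ₂
    totalOrder = record { isTotalOrder = isTotalOrder }

  open import Relation.Binary.Reasoning.Preorder (TotalOrder.preorder totalOrder) public

  -- OrderedField gives _≤_ no fixity, so it binds tighter than _+_.
  +-monoʳ-≤ : ∀ x {y z} → y ≤ z → (x + y) ≤ (x + z)
  +-monoʳ-≤ x {y} {z} y≤z = begin
    x + y ≈⟨ +-comm x y ⟩
    y + x ≲⟨ +-mono-≤ x y≤z ⟩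
    z + x ≈⟨ +-comm z x ⟩
    x + z ∎

  +-mono₂-≤ : ∀ {x y u v} → x ≤ y → u ≤ v → (x + u) ≤ (y + v)
  +-mono₂-≤ {x} {y} {u} {v} x≤y u≤v = begin
    x + u ≲⟨ +-mono-≤ u x≤y ⟩
    y + u ≲⟨ +-monoʳ-≤ y u≤v ⟩
    y + v ∎

  ∑-≤-⋃ : ∀ {m k b} (O : Subset m) (g : Fin m → Carrier) (w : Fin k → Carrier)
          (B : Fin m → Pred (Fin k) b) →
          (∀ {f f′ x} → f ∈ O → f′ ∈ O → B f x → B f′ x → f ≡ f′) →
          (∀ {f} → f ∈ O → ∃[ T ] Represents T (B f) × g f ≤ ∑ T w) →
          ∃[ U ] Represents U (λ x → ∃[ f ] f ∈ O × B f x) × ∑ O g ≤ ∑ U w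
  ∑-≤-⋃ [] g w B disj blocks =
    ⊥ , (λ x → mk⇔ (λ x∈⊥ → contradiction x∈⊥ ∉⊥) (λ { (() , _) })) ,
    (begin ∑ [] g ≈⟨ ∑-⊥ _ w ⟨ ∑ ⊥ w ∎)
  ∑-≤-⋃ (b ∷ O) g w B disj blocks
    with ∑-≤-⋃ O (g ∘ suc) w (B ∘ suc)
           (λ f∈O f′∈O Bx B′x → suc-injective (disj (there f∈O) (there f′∈O) Bx B′x))
           (blocks ∘ there)
  ∑-≤-⋃ (outside ∷ O) g w B disj blocks | U , U≐ , g≤U =
    U , Represents-⇔ U≐ (λ _ → ⇔.sym ∃-∈-outside∷) , g≤U
  ∑-≤-⋃ (inside ∷ O) g w B disj blocks | U , U≐ , g≤U with blocks here
  ... | T , T≐ , g₀≤T = T ∪ U , Represents-⇔ (Represents-∪ T≐ U≐) (λ _ → ⇔.sym ∃-∈-inside∷) , bound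
    where
    T∩U≡∅ : ∀ {x} → x ∈ T → x ∉ U
    T∩U≡∅ {x} x∈T x∈U with to (U≐ x) x∈U
    ... | f , f∈O , Bx with disj here (there f∈O) (to (T≐ x) x∈T) Bx
    ... | ()

    bound : ∑ (inside ∷ O) g ≤ ∑ (T ∪ U) w
    bound = begin
      g zero + ∑ O (g ∘ suc) ≲⟨ +-mono₂-≤ g₀≤T g≤U ⟩
      ∑ T w + ∑ U w          ≈⟨ ∑-∪ T U w T∩U≡∅ ⟨
      ∑ (T ∪ U) w            ∎

module _ {n m : ℕ} (G : Digraph n m) where
  open Digraph G

  private
    variable
      u v x : Fin n

  Reach-trans : Reach G u v → Reach G v x → Reach G u x
  Reach-trans here       q = q
  Reach-trans (step f p) q = step f (Reach-trans p q)

  Reach-uncons : Reach G u v → u ≡ v ⊎ ∃[ f ] tail f ≡ u × Reach G (head f) v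
  Reach-uncons here       = inj₁ refl
  Reach-uncons (step f p) = inj₂ (f , refl , p)

  δ⁺ : Fin n → Subset m
  δ⁺ y = tabulate (λ f → does (tail f ≟ y))

  δ⁺-represents : ∀ y → Represents (δ⁺ y) (λ f → tail f ≡ y)
  δ⁺-represents y = Represents-tabulate (λ f → tail f ≟ y)

  SubArbEdge : Fin m → Pred (Fin m) _
  SubArbEdge e f = f ≡ e ⊎ Reach G (head e) (tail f)

  ChildSubArbEdge : Fin m → Pred (Fin m) _
  ChildSubArbEdge e x = ∃[ f ] f ∈ δ⁺ (head e) × SubArbEdge f x

  ChildSubArbEdge⇒Reach : ∀ {e x} → ChildSubArbEdge e x → Reach G (head e) (tail x)
  ChildSubArbEdge⇒Reach {e} {x} (f , f∈δ⁺ , x∈Aᶠ) =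
    subst (λ y → Reach G y (tail x)) (to (δ⁺-represents (head e) f) f∈δ⁺) (below x∈Aᶠ)
    where
    below : SubArbEdge f x → Reach G (tail f) (tail x)
    below (inj₁ refl) = here
    below (inj₂ r)    = step f r

  SubArbEdge⇔ : ∀ e x → SubArbEdge e x ⇔ (x ≡ e ⊎ ChildSubArbEdge e x)
  SubArbEdge⇔ e x = mk⇔ to′ from′
    where
    child : ∀ {f} → tail f ≡ head e → f ∈ δ⁺ (head e)
    child = from (δ⁺-represents (head e) _)

    to′ : SubArbEdge e x → x ≡ e ⊎ ChildSubArbEdge e x
    to′ (inj₁ x≡e) = inj₁ x≡e
    to′ (inj₂ r) with Reach-uncons r
    ... | inj₁ head-e≡tail-x            = inj₂ (x , child (sym head-e≡tail-x) , inj₁ refl)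
    ... | inj₂ (f , tail-f≡head-e , r′) = inj₂ (f , child tail-f≡head-e , inj₂ r′)

    from′ : x ≡ e ⊎ ChildSubArbEdge e x → SubArbEdge e x
    from′ (inj₁ x≡e)  = inj₁ x≡e
    from′ (inj₂ x∈Aᶠ) = inj₂ (ChildSubArbEdge⇒Reach x∈Aᶠ)

dropFirstEdge : ∀ {n m} → Digraph n (suc m) → Digraph n m
dropFirstEdge G = record { tail = Digraph.tail G ∘ suc ; head = Digraph.head G ∘ suc }

module _ {a} {A : Set a} (_+_ : A → A → A) (0# : A) where

  sumOut≡sumSubset-δ⁺ : ∀ {n m} (G : Digraph n m) y (g : Fin m → A) →
                        sumOut _+_ 0# G y g ≡ sumSubset _+_ 0# (δ⁺ G y) g
  sumOut≡sumSubset-δ⁺ {m = zero}  G y g = refl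
  sumOut≡sumSubset-δ⁺ {m = suc m} G y g with Digraph.tail G zero ≟ y
  ... | yes _ = ≡.cong (g zero +_) (sumOut≡sumSubset-δ⁺ (dropFirstEdge G) y (g ∘ suc))
  ... | no _  = sumOut≡sumSubset-δ⁺ (dropFirstEdge G) y (g ∘ suc)

module Arborescence {n m : ℕ} {G : Digraph n m} (arb : IsArborescence G) where
  open Digraph G
  open IsArborescence arb

  private
    variable
      u v x : Fin n

  Reach-unsnoc : ∀ f → Reach G u (head f) → u ≡ head f ⊎ Reach G u (tail f)
  Reach-unsnoc f here = inj₁ refl
  Reach-unsnoc f (step f′ r) with Reach-unsnoc f r
  ... | inj₁ head-f′≡head-f with indeg≤1 f′ f head-f′≡head-f
  ...   | refl = inj₂ here
  Reach-unsnoc f (step f′ r) | inj₂ r′ = inj₂ (step f′ r′)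

  Reach-comparable : Reach G u x → Reach G v x → Reach G u v ⊎ Reach G v u
  Reach-comparable here       q = inj₂ q
  Reach-comparable (step f p) q with Reach-comparable p q
  ... | inj₁ r = inj₁ (step f r)
  ... | inj₂ r with Reach-unsnoc f r
  ...   | inj₁ refl = inj₁ (step f here)
  ...   | inj₂ r′   = inj₂ r′

  SubArbEdge⇒Reach-head : ∀ {e f} → SubArbEdge G e f → Reach G (head e) (head f)
  SubArbEdge⇒Reach-head         (inj₁ refl) = here
  SubArbEdge⇒Reach-head {f = f} (inj₂ r)    = Reach-trans G r (step f here)

  nested-siblings-equal : ∀ {f f′} → tail f ≡ tail f′ → Reach G (head f) (head f′) → f ≡ f′
  nested-siblings-equal {f} {f′} tails r with Reach-unsnoc f′ r
  ... | inj₁ heads = indeg≤1 f f′ heads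
  ... | inj₂ r′    = contradiction (subst (Reach G (head f)) (sym tails) r′) (acyclic f)

  siblings-disjoint : ∀ {f f′ x} → tail f ≡ tail f′ →
                      SubArbEdge G f x → SubArbEdge G f′ x → f ≡ f′
  siblings-disjoint tails x∈Aᶠ x∈Aᶠ′
    with Reach-comparable (SubArbEdge⇒Reach-head x∈Aᶠ) (SubArbEdge⇒Reach-head x∈Aᶠ′)
  ... | inj₁ r = nested-siblings-equal tails r
  ... | inj₂ r = sym (nested-siblings-equal (sym tails) r)

  δ⁺-siblings-disjoint : ∀ e {f f′ x} → f ∈ δ⁺ G (head e) → f′ ∈ δ⁺ G (head e) →
                         SubArbEdge G f x → SubArbEdge G f′ x → f ≡ f′
  δ⁺-siblings-disjoint e f∈δ⁺ f′∈δ⁺ =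
    siblings-disjoint (trans (tail≡ f∈δ⁺) (sym (tail≡ f′∈δ⁺)))
    where
    tail≡ : ∀ {f} → f ∈ δ⁺ G (head e) → tail f ≡ head e
    tail≡ = to (δ⁺-represents G (head e) _)

  ¬ChildSubArbEdge-self : ∀ e → ¬ ChildSubArbEdge G e e
  ¬ChildSubArbEdge-self e = acyclic e ∘ ChildSubArbEdge⇒Reach G

  _⊏_ : Rel (Fin m) _
  f ⊏ e = Reach G (head e) (tail f)

  δ⁺⇒⊏ : ∀ {e f} → f ∈ δ⁺ G (head e) → f ⊏ e
  δ⁺⇒⊏ {f = f} f∈δ⁺ = ChildSubArbEdge⇒Reach G (f , f∈δ⁺ , inj₁ refl)

  ⊏-isStrictPartialOrder : IsStrictPartialOrder _≡_ _⊏_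
  ⊏-isStrictPartialOrder = record
    { isEquivalence = ≡.isEquivalence
    ; irrefl        = λ { {e} refl → acyclic e }
    ; trans         = λ {f} {g} {e} f⊏g g⊏e → Reach-trans G g⊏e (step g f⊏g)
    ; <-resp-≈      = resp₂ _⊏_
    }

  ⊏-wellFounded : WellFounded _⊏_
  ⊏-wellFounded = spo-wellFounded ⊏-isStrictPartialOrder

module _ {a ℓ₁ ℓ₂} (K : OrderedField a ℓ₁ ℓ₂) {n m : ℕ} {G : Digraph n m}
         (arb : IsArborescence G) (w c : Fin m → OrderedField.Carrier K)
         (triangle : ∀ e → OrderedField._≤_ K (c e)
                             (OrderedField._+_ K (w e)
                               (sumOut (OrderedField._+_ K) (OrderedField.0# K) G (Digraph.head G e) c)))
         where
  open OrderedField K using (_≤_; _+_; 0#; +-congʳ)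
  open OrderedSum K
  open Digraph G
  open Arborescence arb

  BoundedBySubArb : Pred (Fin m) _
  BoundedBySubArb e = ∃[ T ] Represents T (SubArbEdge G e) × c e ≤ ∑ T w

  bounded-by-subArb : ∀ e → BoundedBySubArb e
  bounded-by-subArb = All.wfRec ⊏-wellFounded _ BoundedBySubArb extend
    where
    extend : ∀ e → (∀ {f} → f ⊏ e → BoundedBySubArb f) → BoundedBySubArb e
    extend e below-e
      with ∑-≤-⋃ (δ⁺ G (head e)) c w (SubArbEdge G) (δ⁺-siblings-disjoint e) (below-e ∘ δ⁺⇒⊏)
    ... | U , U≐ , ∑c≤∑U =
      ⁅ e ⁆ ∪ U ,
      Represents-⇔ (Represents-∪ (λ _ → x∈⁅y⁆⇔x≡y) U≐) (λ x → ⇔.sym (SubArbEdge⇔ G e x)) ,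
      (begin
        c e                                ≲⟨ triangle e ⟩
        (w e + sumOut _+_ 0# G (head e) c) ≡⟨ ≡.cong (w e +_) (sumOut≡sumSubset-δ⁺ _+_ 0# G (head e) c) ⟩
        (w e + ∑ (δ⁺ G (head e)) c)        ≲⟨ +-monoʳ-≤ (w e) ∑c≤∑U ⟩
        (w e + ∑ U w)                      ≈⟨ +-congʳ (∑-⁅⁆ e w) ⟨
        (∑ ⁅ e ⁆ w + ∑ U w)                ≈⟨ ∑-∪ ⁅ e ⁆ U w e∉U ⟨
        ∑ (⁅ e ⁆ ∪ U) w                    ∎)
      where
      e∉U : ∀ {x} → x ∈ ⁅ e ⁆ → x ∉ U
      e∉U {x} x∈⁅e⁆ x∈U =
        ¬ChildSubArbEdge-self e (subst (ChildSubArbEdge G e) (x∈⁅y⁆⇒x≡y e x∈⁅e⁆) (to (U≐ x) x∈U))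

lemma9 : ∀ {c ℓ₁ ℓ₂} (K : OrderedField c ℓ₁ ℓ₂) (n m : ℕ) (G : Digraph n m)
         → IsArborescence G
         → (w c' : Fin m → OrderedField.Carrier K)
         → (∀ e → OrderedField._<_ K (OrderedField.0# K) (w e))
         → (∀ e → OrderedField._<_ K (OrderedField.0# K) (c' e))
         → (∀ e → OrderedField._≤_ K (c' e)
                    (OrderedField._+_ K (w e)
                      (sumOut (OrderedField._+_ K) (OrderedField.0# K) G (Digraph.head G e) c')))
         → ∀ (e : Fin m) (S : Subset m) → IsSubArbEdges G e S
         → OrderedField._≤_ K (c' e) (sumSubset (OrderedField._+_ K) (OrderedField.0# K) S w)
lemma9 K n m G arb w c' _ _ triangle e S S≐Aₑ
  with bounded-by-subArb K arb w c' triangle e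
... | T , T≐Aₑ , c≤∑T = subst (λ X → c' e ≤ ∑ X w) (Represents-unique T≐Aₑ S≐Aₑ) c≤∑T
  where
  open OrderedField K using (_≤_)
  open OrderedSum K using (∑)
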